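{- Let $(G,\pi)$ be a parity game, $\tau$ a strategy for Odd, $T$ an $(n,d/2)$-universal tree with $h=d/2$, $\mathcal{C}$ a cover of $\mathcal{T}$, and $\mu:V\to\bar L(T)$ a node labeling such that $G_\tau$ has no loose arcs with respect to $\mu$. Let $v\in B(G_\tau)$ and $j=\pi(v)/2$. For $0\le k<|\mathcal{C}_j|$ let $\xi^k\in\bar L(T)$ be the element returned by $\mathrm{Raise}(\mu(v),\alpha^k(v),j,k)$ (with $\xi^k=\top$ if $\alpha^k(v)=\infty$). Then $\widehat{\mu}(v)=\min_{0\le k<|\mathcal{C}_j|}\xi^k$.
   Context: A parity game: finite directed graph $G=(V,E)$, every node with an outgoing arc, $V=V_0\sqcup V_1$, priorities $\pi:V\to\{1,\dots,d\}$, $d$ even, $n=|V|$. A strategy for Odd is $\tau:V_1\to V$ with $v\tau(v)\in E$; $G_\tau=(V,E_\tau)$ with $E_\tau=\{vw\in E:v\in V_0\}\cup\{v\tau(v):v\in V_1\}$. A strategy for Even is $\sigma:V_0\to V$; $G_\sigma$ keeps all arcs out of $V_1$ and only $v\sigma(v)$ out of $v\in V_0$. For a subgraph $H$, $\pi(H)$ is its maximum priority, $H$ is even if $\pi(H)$ is even, $\Pi(H)$ is the set of nodes of $H$ of priority $\pi(H)$, and $v$ dominates $H$ if $v\in\Pi(H)$. Ordered trees: prefix-closed sets of tuples over a linearly ordered set, viewed as rooted trees, ordered lexicographically; in a tree of height $h$ all leaves are at depth $h$, a leaf is $\xi=(\xi_{2h-1},\dots,\xi_1)$, $\xi|_p$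 deletes the components with index $<p$ (so $\xi|_{2j}$ is the ancestor of $\xi$ at depth $h-j$); $L(T)$ = leaves; $\bar L(T)=L(T)\cup\{\top\}$ with $\top$ maximal, $\top|_p=\top$. $T\sqsubseteq T'$ if there is an injective, edge-preserving, order-preserving map $V(T)\to V(T')$ mapping leaves to leaves; $T\equiv T'$ if both directions hold; $T\sqsubset T'$ if $T\sqsubseteq T'$, $T\not\equiv T'$. An $(\ell,h)$-universal tree is an ordered tree of height $h$ into which every ordered tree of height $h$ with at most $\ell$ leaves all at depth $h$ embeds. For labels from an ordered tree $S$, an arc $vw$ is non-violated w.r.t. a labeling $\nu$ if ($\pi(v)$ even and $\nu(v)|_{\pi(v)}\ge\nu(w)|_{\pi(v)}$) or ($\pi(v)$ odd and ($\nu(v)|_{\pi(v)}>\nu(w)|_{\pi(v)}$ or $\nu(v)=\nu(w)=\top$)); otherwise violated; tight if $\nu(v)$ is the smallest $\xi\in\bar L(S)$ making $vw$ non-violated when replacing $\nu(v)$; loose if neither. $\nu$ is feasible in subgraph $H$ if there is an Even strategy $\sigma$ with $v\sigma(v)\in E(H)$ for every $v\in V_0$ with an outgoing arc in $H$ such that all arcs of $H$ in $G_\sigma$ are non-violated; finite if it never takes value $\top$. Base nodes: $v\in B(G_\tau)$ iff $v\in\Pi(C)$ for some even cycle $C$ of $G_\tau$. Threshold label: $\widehat{\mu}(v):=\min\{\tilde\mu(v):\tilde\mu:V\to\bar L(T),\ \tilde\mu(v)\ge\mu(v),\ \tilde\mu\text{ feasible in some cycle dominated by }v\text{ in }G_\tau\}$.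 Covers and widths: $\mathcal{T}_j$ is the set of pairwise non-equivalent subtrees of $T$ rooted at depth $h-j$, $\mathcal{T}=\bigcup_j\mathcal{T}_j$. A cover $\mathcal{C}=(\mathcal{C}_0,\dots,\mathcal{C}_h)$ of $\mathcal{T}$ consists of tuples $\mathcal{C}_j=(\mathcal{C}^0_j,\dots,\mathcal{C}^\ell_j)$ of chains of $(\mathcal{T}_j,\sqsubseteq)$ whose union is $\mathcal{T}_j$; chain $\mathcal{C}^k_j$ is $T^k_{0,j}\sqsubset T^k_{1,j}\sqsubset\cdots$. For a subgraph $H$ of $G_\tau$ with $j=\lceil\pi(H)/2\rceil$, $\alpha^k(H)$ is the least $i$ such that $H$ admits a finite feasible labeling $V(H)\to L(T^k_{i,j})$ ($\infty$ if none). For a base node $v$, $\alpha^k(v)$ is the minimum of $\alpha^k(C)$ over cycles $C$ of $G_\tau$ dominated by $v$. $\mathrm{Raise}(\xi,i,j,k)$, for $\xi\in L(T)$, integers $i\ge0$, $j\in[h]$, $k\ge0$, returns the smallest leaf $\xi'\in L(T)$ such that $\xi'\ge\xi$ and $\xi'$ is the smallest leaf of the subtree of $T$ rooted at $\xi'|_{2j}$, that subtree being equivalent to $T^k_{i',j}$ for some $i'\ge i$; it returns $\top$ if no such leaf exists. -}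

module Defs where

open import Level using (0ℓ)
open import Data.Nat using (ℕ; zero; suc; _≤_; _<_; _∸_; _/_; _*_)
open import Data.Nat.Divisibility using (_∣_)
open import Data.Fin using (Fin)
open import Data.List using (List; []; _∷_; _++_; [_]; _∷ʳ_; take; length; lookup)
open import Data.List.Membership.Propositional using (_∈_)
open import Data.List.Relation.Unary.Unique.Propositional using (Unique)
open import Data.List.Relation.Unary.Linked using (Linked)
open import Data.Maybe using (Maybe; just; nothing)
open import Data.Product using (Σ; ∃; _×_; _,_)
open import Data.Sum using (_⊎_)
open import Relation.Binary.PropositionalEquality using (_≡_)
open import Relation.Nullary using (¬_)
open import Data.Unit using (⊤)

data Player : Set where
  Even Odd : Player

record Game (n d : ℕ) : Set₁ where
  field
    E          : Fin n → Fin n → Set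
    owner      : Fin n → Player
    prio       : Fin n → ℕ
    prio-range : ∀ v → 1 ≤ prio v × prio v ≤ d
    total      : ∀ v → ∃ λ w → E v w
    d-even     : 2 ∣ d

module _ {n d : ℕ} (G : Game n d) where
  open Game G

  -- a strategy for Odd: τ : V → V, only its values on V₁ matter
  OddStrategy : (Fin n → Fin n) → Set
  OddStrategy τ = ∀ v → owner v ≡ Odd → E v (τ v)

  Eτ : (Fin n → Fin n) → Fin n → Fin n → Set
  Eτ τ v w = (owner v ≡ Even × E v w) ⊎ (owner v ≡ Odd × w ≡ τ v)

record Sub (n : ℕ) : Set₁ where
  field
    nodes : Fin n → Set
    arcs  : Fin n → Fin n → Set

data Consec {A : Set} : List A → A → A → Set where
  here  : ∀ {u w xs} → Consec (u ∷ w ∷ xs) u w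
  there : ∀ {x xs u w} → Consec xs u w → Consec (x ∷ xs) u w

record Cycle {n : ℕ} (R : Fin n → Fin n → Set) : Set where
  field
    hd     : Fin n
    tl     : List (Fin n)
    uniq   : Unique (hd ∷ tl)
    linked : Linked R ((hd ∷ tl) ++ [ hd ])

module _ {n : ℕ} {R : Fin n → Fin n → Set} where
  cycNodes : Cycle R → List (Fin n)
  cycNodes C = Cycle.hd C ∷ Cycle.tl C

  asSub : Cycle R → Sub n
  asSub C = record
    { nodes = λ u → u ∈ cycNodes C
    ; arcs  = λ u w → Consec (cycNodes C ++ [ Cycle.hd C ]) u w }

Dominates : {n : ℕ} {R : Fin n → Fin n → Set} → (Fin n → ℕ) → Fin n → Cycle R → Set
Dominates prio v C = v ∈ cycNodes C × (∀ u → u ∈ cycNodes C → prio u ≤ prio v)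

-- Ordered trees: prefix-closed sets of tuples over ℕ (root-first lists).

OTree : Set₁
OTree = List ℕ → Set

data _<L_ : List ℕ → List ℕ → Set where
  []<∷  : ∀ {y ys} → [] <L (y ∷ ys)
  head< : ∀ {x y xs ys} → x < y → (x ∷ xs) <L (y ∷ ys)
  tail< : ∀ {x xs ys} → xs <L ys → (x ∷ xs) <L (x ∷ ys)

_≤L_ : List ℕ → List ℕ → Set
xs ≤L ys = xs ≡ ys ⊎ xs <L ys

IsLeafOf : OTree → List ℕ → Set
IsLeafOf S u = S u × (∀ c → ¬ S (u ∷ʳ c))

IsTreeOfHeight : OTree → ℕ → Set
IsTreeOfHeight S h =
  S [] ×
  (∀ u s → S (u ++ s) → S u) ×
  (∀ u → S u → length u ≤ h) ×
  (∀ u → S u → length u < h → ∃ λ c → S (u ∷ʳ c))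

_⊑_ : OTree → OTree → Set
S ⊑ S' = Σ (List ℕ → List ℕ) λ f →
  (∀ u → S u → S' (f u)) ×
  (∀ u u' → S u → S u' → f u ≡ f u' → u ≡ u') ×
  (∀ u c → S u → S (u ∷ʳ c) → ∃ λ c' → f (u ∷ʳ c) ≡ f u ∷ʳ c') ×
  (∀ u u' → S u → S u' → u <L u' → f u <L f u') ×
  (∀ u → IsLeafOf S u → IsLeafOf S' (f u))

_≡T_ : OTree → OTree → Set
S ≡T S' = S ⊑ S' × S' ⊑ S

_⊏_ : OTree → OTree → Set
S ⊏ S' = S ⊑ S' × ¬ (S ≡T S')

subtree : OTree → List ℕ → OTree
subtree S u s = S (u ++ s)

IsUniversal : ℕ → ℕ → OTree → Set₁
IsUniversal ℓ h T =
  IsTreeOfHeight T h ×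
  (∀ (S : OTree) → IsTreeOfHeight S h →
     (∃ λ (ls : List (List ℕ)) → length ls ≤ ℓ × (∀ s → IsLeafOf S s → s ∈ ls)) →
     S ⊑ T)

data Lab : Set where
  leaf : List ℕ → Lab
  top  : Lab

data _<Lab_ : Lab → Lab → Set where
  leaf<leaf : ∀ {xs ys} → xs <L ys → leaf xs <Lab leaf ys
  leaf<top  : ∀ {xs} → leaf xs <Lab top

_≤Lab_ : Lab → Lab → Set
a ≤Lab b = a ≡ b ⊎ a <Lab b

InLbar : OTree → Lab → Set
InLbar S (leaf xs) = IsLeafOf S xs
InLbar S top       = ⊤



-- truncation ξ|_p for leaves of a tree of height m:
-- ξ = (ξ_{2m-1},…,ξ_1) (root-first); delete components with index < p
truncL : ℕ → ℕ → List ℕ → List ℕ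
truncL m p xs = take (m ∸ p / 2) xs

trunc : ℕ → ℕ → Lab → Lab
trunc m p (leaf xs) = leaf (truncL m p xs)
trunc m p top       = top

NonViolated : ℕ → ℕ → Lab → Lab → Set
NonViolated m p a b =
  (2 ∣ p × trunc m p b ≤Lab trunc m p a) ⊎
  (¬ (2 ∣ p) × (trunc m p b <Lab trunc m p a ⊎ (a ≡ top × b ≡ top)))

Tight : OTree → ℕ → ℕ → Lab → Lab → Set
Tight S m p a b = NonViolated m p a b × (∀ x → InLbar S x → NonViolated m p x b → a ≤Lab x)

Loose : OTree → ℕ → ℕ → Lab → Lab → Set
Loose S m p a b = NonViolated m p a b × ¬ Tight S m p a b

module GameDefs {n d : ℕ} (G : Game n d) where
  open Game G

  Feasible : ℕ → (Fin n → Lab) → Sub n → Set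
  Feasible m ν H = Σ (Fin n → Fin n) λ σ →
    (∀ v → owner v ≡ Even → E v (σ v)) ×
    (∀ v → owner v ≡ Even → (∃ λ w → Sub.arcs H v w) → Sub.arcs H v (σ v)) ×
    (∀ v w → Sub.arcs H v w → (owner v ≡ Odd ⊎ (owner v ≡ Even × w ≡ σ v)) →
       NonViolated m (prio v) (ν v) (ν w))

  module WithTau (τ : Fin n → Fin n) where

    CycleGτ : Set
    CycleGτ = Cycle (Eτ G τ)

    BaseNode : Fin n → Set
    BaseNode v = ∃ λ (C : CycleGτ) → Dominates prio v C × 2 ∣ prio v

    NoLooseArcs : OTree → ℕ → (Fin n → Lab) → Set
    NoLooseArcs T h μ = ∀ v w → Eτ G τ v w → ¬ Loose T h (prio v) (μ v) (μ w)

    -- the set whose minimum is μ̂(v)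
    ThresholdCand : OTree → ℕ → (Fin n → Lab) → Fin n → Lab → Set
    ThresholdCand T h μ v y = Σ (Fin n → Lab) λ μ~ →
      (∀ u → InLbar T (μ~ u)) × μ~ v ≡ y × μ v ≤Lab y ×
      (∃ λ (C : CycleGτ) → Dominates prio v C × Feasible h μ~ (asSub C))

IsLeast : {A : Set} → (A → A → Set) → (A → Set) → A → Set
IsLeast _≤_ P x = P x × (∀ y → P y → x ≤ y)

-- ℕ∞ = Maybe ℕ, with nothing = ∞
ℕ∞ : Set
ℕ∞ = Maybe ℕ

data _≤∞_ : ℕ∞ → ℕ∞ → Set where
  fin≤fin : ∀ {i i'} → i ≤ i' → just i ≤∞ just i'
  ≤∞inf   : ∀ a → a ≤∞ nothing

LeastOrInf : (ℕ → Set) → ℕ∞ → Set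
LeastOrInf P (just i) = P i × (∀ i' → i' < i → ¬ P i')
LeastOrInf P nothing  = ∀ i → ¬ P i

at : {A : Set} → List A → ℕ → Maybe A
at []       _       = nothing
at (x ∷ xs) zero    = just x
at (x ∷ xs) (suc i) = at xs i

-- A cover of 𝒯 for a tree T of height h.  The elements of 𝒯_j (subtrees rooted at
-- depth h - j, up to ≡) are represented by nodes of T at depth h - j.
record Cover (T : OTree) (h : ℕ) : Set₁ where
  field
    chains   : ℕ → List (List (List ℕ))     -- 𝒞_j = chains j, 𝒞^k_j = k-th list
    elems    : ∀ j → j ≤ h → ∀ ch → ch ∈ chains j → ∀ u → u ∈ ch →
                 T u × length u ≡ h ∸ j
    strict   : ∀ j → j ≤ h → ∀ ch → ch ∈ chains j → ∀ u u' → Consec ch u u' →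
                 subtree T u ⊏ subtree T u'
    covering : ∀ j → j ≤ h → ∀ u → T u → length u ≡ h ∸ j →
                 ∃ λ ch → ch ∈ chains j × ∃ λ u' → u' ∈ ch × subtree T u ≡T subtree T u'

  chainAt : (j : ℕ) → Fin (length (chains j)) → ℕ → Maybe (List ℕ)
  chainAt j k i = at (lookup (chains j) k) i

module Alpha {n d : ℕ} (G : Game n d) (τ : Fin n → Fin n)
             (T : OTree) (h : ℕ) (𝒞 : Cover T h) where
  open Game G
  open GameDefs G
  open WithTau τ
  open Cover 𝒞

  AdmitsFiniteFeasible : ℕ → OTree → Sub n → Set
  AdmitsFiniteFeasible j S H = Σ (Fin n → Lab) λ ν →
    (∀ u → Sub.nodes H u → ∃ λ s → ν u ≡ leaf s × IsLeafOf S s) × Feasible j ν H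

  IsAlphaCycle : (j : ℕ) → Fin (length (chains j)) → CycleGτ → ℕ∞ → Set
  IsAlphaCycle j k C = LeastOrInf λ i →
    ∃ λ u → chainAt j k i ≡ just u × AdmitsFiniteFeasible j (subtree T u) (asSub C)

  IsAlphaNode : (j : ℕ) → Fin (length (chains j)) → Fin n → ℕ∞ → Set
  IsAlphaNode j k v = IsLeast _≤∞_ λ a →
    ∃ λ (C : CycleGτ) → Dominates prio v C × IsAlphaCycle j k C a

  RaiseCand : Lab → ℕ → (j : ℕ) → Fin (length (chains j)) → Lab → Set
  RaiseCand ξ i j k (leaf ξ') =
    IsLeafOf T ξ' × ξ ≤Lab leaf ξ' ×
    (∀ ζ → IsLeafOf T ζ → truncL h (2 * j) ζ ≡ truncL h (2 * j) ξ' → ξ' ≤L ζ) ×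
    (∃ λ i' → i ≤ i' × ∃ λ u → chainAt j k i' ≡ just u ×
       subtree T (truncL h (2 * j) ξ') ≡T subtree T u)
  RaiseCand ξ i j k top = ⊤

  -- r = Raise(ξ,i,j,k): the least candidate leaf, or ⊤ if none (⊤ is maximal)
  IsRaise : Lab → ℕ → (j : ℕ) → Fin (length (chains j)) → Lab → Set
  IsRaise ξ i j k = IsLeast _≤Lab_ (RaiseCand ξ i j k)

  IsXi : Lab → (j : ℕ) → Fin (length (chains j)) → ℕ∞ → Lab → Set
  IsXi μv j k (just a) x = IsRaise μv a j k x
  IsXi μv j k nothing  x = x ≡ top

module Submission where

-- Fix a cycle C of G_τ dominated by v and let j = π(v)/2.  All priorities on C are at
-- most 2j, so along every arc of C a feasible labelling can only decrease the ancestor of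
-- the label at depth h − j; going around the cycle, this ancestor u is constant.  Cutting u
-- off turns a threshold candidate into a finite feasible labelling of C by leaves of the
-- subtree at u.  Conversely, a finite feasible labelling by leaves of a subtree embedding
-- into the one at u can be moved under u and extended to a threshold candidate carrying
-- the leftmost leaf below u at v.  By the cover, u is equivalent to some T^k_{i,j}, and C
-- then witnesses α^k(v) ≤ i; this matches threshold candidates with Raise candidates.
-- Finally, μ(v) lies below the leftmost leaf under u because no arc is loose: backwards
-- along C this gives μ ≤ μ~, and the even arc leaving v is then either increasing in its
-- truncation or tight.

open import Defs
open import Data.Nat using (ℕ; zero; suc; _≤_; _<_; _∸_; _+_; _*_; _/_; _⊓_; z≤n; s≤s)
open import Data.Nat.Properties as ℕ using (<-cmp)
open import Data.Nat.Divisibility using (_∣_; _∣?_)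
open import Data.Nat.DivMod using (m*n/n≡m; /-monoˡ-≤)
open import Data.List using (List; []; _∷_; _++_; take; drop; length; _∷ʳ_; [_])
open import Data.List.Properties
  using (++-cancelˡ; take-take; take++drop≡id; length-++; length-take; take-all; ++-assoc; ++-identityʳ)
open import Function using (_∘_)
open import Data.List.Membership.Propositional using (_∈_)
open import Data.List.Relation.Unary.Any as Any using (here; there)
open import Data.List.Relation.Unary.Any.Properties using (lookup-index)
open import Data.List.Membership.Propositional.Properties using (∈-lookup)
open import Data.List.Relation.Unary.All using (_∷_)
open import Data.List.Relation.Unary.AllPairs using (_∷_)
open import Data.List.Relation.Unary.All.Properties using (All¬⇒¬Any)
open import Data.List.Relation.Unary.Linked using (Linked; _∷_)
open import Data.List.Relation.Unary.Unique.Propositional using (Unique)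
open import Relation.Binary.Construct.Closure.ReflexiveTransitive using (Star; ε; _◅_; _◅◅_; gmap; fold)
open import Data.Product using (∃; _×_; _,_; proj₁; proj₂)
open import Data.Sum using (_⊎_; inj₁; inj₂)
open import Data.Empty using (⊥-elim)
open import Data.Unit using (tt)
open import Data.Fin using (Fin; _≟_)
import Data.Fin as Fin
open import Data.Maybe using (just; nothing)
open import Relation.Nullary using (¬_; Dec; yes; no)
open import Relation.Nullary.Negation using (¬¬-Monad; ¬¬-map)
open import Relation.Nullary.Decidable using (decidable-stable)
open import Effect.Monad using (RawMonad)
open import Level using (0ℓ)
open import Relation.Binary.Definitions using (tri<; tri≈; tri>)
open import Relation.Binary.PropositionalEquality hiding ([_])

open RawMonad (¬¬-Monad {0ℓ}) using (pure; _>>=_)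

<L-irrefl : ∀ {xs} → ¬ xs <L xs
<L-irrefl (head< x<x) = ℕ.<-irrefl refl x<x
<L-irrefl (tail< p)   = <L-irrefl p

<L-trans : ∀ {xs ys zs} → xs <L ys → ys <L zs → xs <L zs
<L-trans []<∷      (head< _) = []<∷
<L-trans []<∷      (tail< _) = []<∷
<L-trans (head< p) (head< q) = head< (ℕ.<-trans p q)
<L-trans (head< p) (tail< _) = head< p
<L-trans (tail< _) (head< q) = head< q
<L-trans (tail< p) (tail< q) = tail< (<L-trans p q)

<L-≤L-total : ∀ xs ys → xs <L ys ⊎ ys ≤L xs
<L-≤L-total []       []       = inj₂ (inj₁ refl)
<L-≤L-total []       (y ∷ ys) = inj₁ []<∷
<L-≤L-total (x ∷ xs) []       = inj₂ (inj₂ []<∷)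
<L-≤L-total (x ∷ xs) (y ∷ ys) with <-cmp x y
... | tri< x<y _ _ = inj₁ (head< x<y)
... | tri> _ _ y<x = inj₂ (inj₂ (head< y<x))
... | tri≈ _ refl _ with <L-≤L-total xs ys
...   | inj₁ xs<ys        = inj₁ (tail< xs<ys)
...   | inj₂ (inj₁ refl) = inj₂ (inj₁ refl)
...   | inj₂ (inj₂ ys<xs) = inj₂ (inj₂ (tail< ys<xs))

≤L-trans : ∀ {xs ys zs} → xs ≤L ys → ys ≤L zs → xs ≤L zs
≤L-trans (inj₁ refl) q           = q
≤L-trans (inj₂ p)    (inj₁ refl) = inj₂ p
≤L-trans (inj₂ p)    (inj₂ q)    = inj₂ (<L-trans p q)

≤L⇒≯L : ∀ {xs ys} → xs ≤L ys → ¬ ys <L xs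
≤L⇒≯L (inj₁ refl) q = <L-irrefl q
≤L⇒≯L (inj₂ p)    q = <L-irrefl (<L-trans p q)

≤L-antisym : ∀ {xs ys} → xs ≤L ys → ys ≤L xs → xs ≡ ys
≤L-antisym (inj₁ e) _        = e
≤L-antisym (inj₂ p) (inj₁ e) = sym e
≤L-antisym (inj₂ p) (inj₂ q) = ⊥-elim (≤L⇒≯L (inj₂ p) q)

[]-≤L : ∀ xs → [] ≤L xs
[]-≤L []      = inj₁ refl
[]-≤L (_ ∷ _) = inj₂ []<∷

take-mono-<L : ∀ k {xs ys} → xs <L ys → take k xs ≤L take k ys
take-mono-<L zero    _         = inj₁ refl
take-mono-<L (suc k) []<∷      = inj₂ []<∷
take-mono-<L (suc k) (head< p) = inj₂ (head< p)
take-mono-<L (suc k) {x ∷ _} (tail< p) with take-mono-<L k p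
... | inj₁ e = inj₁ (cong (x ∷_) e)
... | inj₂ q = inj₂ (tail< q)

take-mono-≤L : ∀ k {xs ys} → xs ≤L ys → take k xs ≤L take k ys
take-mono-≤L k (inj₁ refl) = inj₁ refl
take-mono-≤L k (inj₂ p)    = take-mono-<L k p

take-reflects-<L : ∀ k {xs ys} → take k xs <L take k ys → xs <L ys
take-reflects-<L k {xs} {ys} p with <L-≤L-total xs ys
... | inj₁ q  = q
... | inj₂ q = ⊥-elim (≤L⇒≯L (take-mono-≤L k q) p)

++-monoʳ-<L : ∀ pre {xs ys} → xs <L ys → (pre ++ xs) <L (pre ++ ys)
++-monoʳ-<L []        p = p
++-monoʳ-<L (_ ∷ pre) p = tail< (++-monoʳ-<L pre p)

++-cancelˡ-<L : ∀ pre {xs ys} → (pre ++ xs) <L (pre ++ ys) → xs <L ys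
++-cancelˡ-<L []        p           = p
++-cancelˡ-<L (_ ∷ pre) (head< x<x) = ⊥-elim (ℕ.<-irrefl refl x<x)
++-cancelˡ-<L (_ ∷ pre) (tail< p)   = ++-cancelˡ-<L pre p

++-monoʳ-≤L : ∀ pre {xs ys} → xs ≤L ys → (pre ++ xs) ≤L (pre ++ ys)
++-monoʳ-≤L pre (inj₁ refl) = inj₁ refl
++-monoʳ-≤L pre (inj₂ p)    = inj₂ (++-monoʳ-<L pre p)

++-cancelˡ-≤L : ∀ pre {xs ys} → (pre ++ xs) ≤L (pre ++ ys) → xs ≤L ys
++-cancelˡ-≤L pre (inj₁ e) = inj₁ (++-cancelˡ pre _ _ e)
++-cancelˡ-≤L pre (inj₂ p) = inj₂ (++-cancelˡ-<L pre p)

take-++ : ∀ (pre : List ℕ) k xs → take (length pre + k) (pre ++ xs) ≡ pre ++ take k xs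
take-++ []        k xs = refl
take-++ (x ∷ pre) k xs = cong (x ∷_) (take-++ pre k xs)

take-length-++ : ∀ (pre : List ℕ) xs → take (length pre) (pre ++ xs) ≡ pre
take-length-++ []        xs = refl
take-length-++ (x ∷ pre) xs = cong (x ∷_) (take-length-++ pre xs)

<Lab-irrefl : ∀ {a} → ¬ a <Lab a
<Lab-irrefl (leaf<leaf p) = <L-irrefl p

<Lab-trans : ∀ {a b c} → a <Lab b → b <Lab c → a <Lab c
<Lab-trans (leaf<leaf p) (leaf<leaf q) = leaf<leaf (<L-trans p q)
<Lab-trans (leaf<leaf p) leaf<top      = leaf<top

≤Lab-trans : ∀ {a b c} → a ≤Lab b → b ≤Lab c → a ≤Lab c
≤Lab-trans (inj₁ refl) q           = q
≤Lab-trans (inj₂ p)    (inj₁ refl) = inj₂ p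
≤Lab-trans (inj₂ p)    (inj₂ q)    = inj₂ (<Lab-trans p q)

≤Lab-<Lab-trans : ∀ {a b c} → a ≤Lab b → b <Lab c → a <Lab c
≤Lab-<Lab-trans (inj₁ refl) q = q
≤Lab-<Lab-trans (inj₂ p)    q = <Lab-trans p q

<Lab-≤Lab-trans : ∀ {a b c} → a <Lab b → b ≤Lab c → a <Lab c
<Lab-≤Lab-trans p (inj₁ refl) = p
<Lab-≤Lab-trans p (inj₂ q)    = <Lab-trans p q

≤Lab⇒≯Lab : ∀ {a b} → a ≤Lab b → ¬ b <Lab a
≤Lab⇒≯Lab p q = <Lab-irrefl (≤Lab-<Lab-trans p q)

<Lab-≤Lab-total : ∀ a b → a <Lab b ⊎ b ≤Lab a
<Lab-≤Lab-total (leaf xs) (leaf ys) with <L-≤L-total xs ys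
... | inj₁ p           = inj₁ (leaf<leaf p)
... | inj₂ (inj₁ refl) = inj₂ (inj₁ refl)
... | inj₂ (inj₂ p)    = inj₂ (inj₂ (leaf<leaf p))
<Lab-≤Lab-total (leaf _)  top      = inj₁ leaf<top
<Lab-≤Lab-total top       (leaf _) = inj₂ (inj₂ leaf<top)
<Lab-≤Lab-total top       top      = inj₂ (inj₁ refl)

≰Lab⇒≥Lab : ∀ {a b} → ¬ a ≤Lab b → b ≤Lab a
≰Lab⇒≥Lab {a} {b} a≰b with <Lab-≤Lab-total a b
... | inj₁ a<b = ⊥-elim (a≰b (inj₂ a<b))
... | inj₂ b≤a = b≤a

_≤Lab?_ : ∀ a b → Dec (a ≤Lab b)
a ≤Lab? b with <Lab-≤Lab-total b a
... | inj₁ b<a = no (λ a≤b → ≤Lab⇒≯Lab a≤b b<a)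
... | inj₂ a≤b = yes a≤b

≤Lab-top : ∀ a → a ≤Lab top
≤Lab-top (leaf _) = inj₂ leaf<top
≤Lab-top top      = inj₁ refl

leaf-≤Lab : ∀ {xs ys} → xs ≤L ys → leaf xs ≤Lab leaf ys
leaf-≤Lab (inj₁ refl) = inj₁ refl
leaf-≤Lab (inj₂ p)    = inj₂ (leaf<leaf p)

leaf-≤Lab⁻ : ∀ {xs ys} → leaf xs ≤Lab leaf ys → xs ≤L ys
leaf-≤Lab⁻ (inj₁ refl)          = inj₁ refl
leaf-≤Lab⁻ (inj₂ (leaf<leaf p)) = inj₂ p

trunc-mono-≤Lab : ∀ m p {a b} → a ≤Lab b → trunc m p a ≤Lab trunc m p b
trunc-mono-≤Lab m p (inj₁ refl)          = inj₁ refl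
trunc-mono-≤Lab m p (inj₂ (leaf<leaf q)) = leaf-≤Lab (take-mono-<L _ q)
trunc-mono-≤Lab m p (inj₂ leaf<top)      = inj₂ leaf<top

trunc-reflects-<Lab : ∀ m p {a b} → trunc m p a <Lab trunc m p b → a <Lab b
trunc-reflects-<Lab m p {leaf _} {leaf _} (leaf<leaf q) = leaf<leaf (take-reflects-<L _ q)
trunc-reflects-<Lab m p {leaf _} {top}    _             = leaf<top

≤Lab-antisym : ∀ {a b} → a ≤Lab b → b ≤Lab a → a ≡ b
≤Lab-antisym (inj₁ e) _        = e
≤Lab-antisym (inj₂ p) (inj₁ e) = sym e
≤Lab-antisym (inj₂ p) (inj₂ q) = ⊥-elim (≤Lab⇒≯Lab (inj₂ p) q)

trunc-trunc : ∀ m p q {a} → p / 2 ≤ q / 2 → trunc m q (trunc m p a) ≡ trunc m q a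
trunc-trunc m p q {leaf xs} p≤q = cong leaf (begin
  take (m ∸ q / 2) (take (m ∸ p / 2) xs)  ≡⟨ take-take (m ∸ q / 2) (m ∸ p / 2) xs ⟩
  take ((m ∸ q / 2) ⊓ (m ∸ p / 2)) xs     ≡⟨ cong (λ k → take k xs) (ℕ.m≤n⇒m⊓n≡m (ℕ.∸-monoʳ-≤ m p≤q)) ⟩
  take (m ∸ q / 2) xs                     ∎)
  where open ≡-Reasoning
trunc-trunc m p q {top}     _   = refl

NonViolated-monoˡ : ∀ m p {a a' b} → NonViolated m p a b → a ≤Lab a' → NonViolated m p a' b
NonViolated-monoˡ m p (inj₁ (e , q)) r = inj₁ (e , ≤Lab-trans q (trunc-mono-≤Lab m p r))
NonViolated-monoˡ m p (inj₂ (o , inj₁ q)) r = inj₂ (o , inj₁ (<Lab-≤Lab-trans q (trunc-mono-≤Lab m p r)))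
NonViolated-monoˡ m p (inj₂ (o , inj₂ (refl , refl))) (inj₁ refl) = inj₂ (o , inj₂ (refl , refl))

NonViolated-antitoneʳ : ∀ m p {a b b'} → NonViolated m p a b → b' ≤Lab b → NonViolated m p a b'
NonViolated-antitoneʳ m p (inj₁ (e , q)) r = inj₁ (e , ≤Lab-trans (trunc-mono-≤Lab m p r) q)
NonViolated-antitoneʳ m p (inj₂ (o , inj₁ q)) r = inj₂ (o , inj₁ (≤Lab-<Lab-trans (trunc-mono-≤Lab m p r) q))
NonViolated-antitoneʳ m p (inj₂ (o , inj₂ (refl , refl))) (inj₁ refl)     = inj₂ (o , inj₂ (refl , refl))
NonViolated-antitoneʳ m p (inj₂ (o , inj₂ (refl , refl))) (inj₂ leaf<top) = inj₂ (o , inj₁ leaf<top)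

NonViolated-top : ∀ m p → NonViolated m p top top
NonViolated-top m p with 2 ∣? p
... | yes e = inj₁ (e , inj₁ refl)
... | no o  = inj₂ (o , inj₂ (refl , refl))

NonViolated⇒trunc-≤ : ∀ m p {a b} → NonViolated m p a b → trunc m p b ≤Lab trunc m p a
NonViolated⇒trunc-≤ m p (inj₁ (_ , q))                 = q
NonViolated⇒trunc-≤ m p (inj₂ (_ , inj₁ q))            = inj₂ q
NonViolated⇒trunc-≤ m p (inj₂ (_ , inj₂ (refl , refl))) = inj₁ refl

NonViolated-leaf-transfer : ∀ {m m' p a b a' b'} →
  (truncL m p b ≤L truncL m p a → truncL m' p b' ≤L truncL m' p a') →
  (truncL m p b <L truncL m p a → truncL m' p b' <L truncL m' p a') →
  NonViolated m p (leaf a) (leaf b) → NonViolated m' p (leaf a') (leaf b')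
NonViolated-leaf-transfer ≤-transfer _ (inj₁ (e , q)) = inj₁ (e , leaf-≤Lab (≤-transfer (leaf-≤Lab⁻ q)))
NonViolated-leaf-transfer _ <-transfer (inj₂ (o , inj₁ (leaf<leaf q))) = inj₂ (o , inj₁ (leaf<leaf (<-transfer q)))

mapLab : (List ℕ → List ℕ) → Lab → Lab
mapLab f (leaf xs) = leaf (f xs)
mapLab f top       = top

trunc≡leaf⁻ : ∀ m p {a xs} → trunc m p a ≡ leaf xs → ∃ λ ys → a ≡ leaf ys × truncL m p ys ≡ xs
trunc≡leaf⁻ m p {leaf ys} refl = ys , refl , refl

NonViolated-even-respects-trunc : ∀ m p {a a' b} → 2 ∣ p → trunc m p a ≡ trunc m p a' →
  NonViolated m p a b → NonViolated m p a' b
NonViolated-even-respects-trunc m p _    e (inj₁ (ev , q)) = inj₁ (ev , subst (trunc m p _ ≤Lab_) e q)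
NonViolated-even-respects-trunc m p 2∣p _ (inj₂ (odd , _)) = ⊥-elim (odd 2∣p)

argmin : ∀ {K} → Fin K → (f : Fin K → Lab) → ∃ λ k → ∀ k' → f k ≤Lab f k'
argmin {suc zero}    _ f = Fin.zero , λ { Fin.zero → inj₁ refl }
argmin {suc (suc K)} _ f with argmin Fin.zero (f ∘ Fin.suc)
... | k , k-min with <Lab-≤Lab-total (f Fin.zero) (f (Fin.suc k))
...   | inj₁ f0<fk =
  Fin.zero , λ { Fin.zero → inj₁ refl ; (Fin.suc k') → ≤Lab-trans (inj₂ f0<fk) (k-min k') }
...   | inj₂ fk≤f0 = Fin.suc k , λ { Fin.zero → fk≤f0 ; (Fin.suc k') → k-min k' }

¬¬-least : (P : ℕ → Set) → ∀ {c} → P c → ¬ ¬ (∃ λ m → P m × (∀ m' → m' < m → ¬ P m'))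
¬¬-least P {c} pc ¬least = no-witness-below (suc c) c ℕ.≤-refl pc
  where
  no-witness-below : ∀ b c → c < b → ¬ P c
  no-witness-below (suc b) c (s≤s c≤b) pc =
    ¬least (c , pc , λ c' c'<c → no-witness-below b c' (ℕ.≤-trans c'<c c≤b))

-- Membership in an ordered tree is not decidable, so the leftmost leaf exists only up to
-- double negation; the comparisons it is used for are decidable.
IsLeftmostLeaf : OTree → List ℕ → Set
IsLeftmostLeaf S r = IsLeafOf S r × (∀ r' → IsLeafOf S r' → r ≤L r')

module _ {S : OTree} {h : ℕ} (tS : IsTreeOfHeight S h) where
  private
    prefix-closed : ∀ u s → S (u ++ s) → S u
    prefix-closed = proj₁ (proj₂ tS)

    depth-≤ : ∀ u → S u → length u ≤ h
    depth-≤ = proj₁ (proj₂ (proj₂ tS))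

    has-child : ∀ u → S u → length u < h → ∃ λ c → S (u ∷ʳ c)
    has-child = proj₂ (proj₂ (proj₂ tS))

  leaf-depth : ∀ {r} → IsLeafOf S r → length r ≡ h
  leaf-depth {r} (Sr , childless) with length r ℕ.<? h
  ... | yes r<h = ⊥-elim (childless _ (proj₂ (has-child r Sr r<h)))
  ... | no  r≮h = ℕ.≤-antisym (depth-≤ r Sr) (ℕ.≮⇒≥ r≮h)

  node-at-depth : ∀ k → k ≤ h → ∃ λ u → S u × length u ≡ k
  node-at-depth zero    _   = [] , proj₁ tS , refl
  node-at-depth (suc k) k<h with node-at-depth k (ℕ.<⇒≤ k<h)
  ... | u , Su , refl with has-child u Su k<h
  ...   | c , Suc = u ∷ʳ c , Suc , trans (length-++ u) (ℕ.+-comm (length u) 1)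

  take-node : ∀ k {u} → S u → S (take k u)
  take-node k {u} Su = prefix-closed (take k u) (drop k u) (subst S (sym (take++drop≡id k u)) Su)

  subtree-isTree : ∀ {w k} → S w → length w + k ≡ h → IsTreeOfHeight (subtree S w) k
  subtree-isTree {w} {k} Sw w+k≡h =
      subst S (sym (++-identityʳ w)) Sw
    , (λ u s Swus → prefix-closed (w ++ u) s (subst S (sym (++-assoc w u s)) Swus))
    , (λ u Swu → ℕ.+-cancelˡ-≤ (length w) (length u) k
                   (subst₂ _≤_ (length-++ w) (sym w+k≡h) (depth-≤ (w ++ u) Swu)))
    , λ u Swu u<k → let c , Swuc = has-child (w ++ u) Swu (subst₂ _<_ (sym (length-++ w)) w+k≡h
                                                                (ℕ.+-monoʳ-< (length w) u<k))
                    in c , subst S (++-assoc w u [ c ]) Swuc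

subtree-leaf⁺ : ∀ S w {r} → IsLeafOf (subtree S w) r → IsLeafOf S (w ++ r)
subtree-leaf⁺ S w {r} (Swr , childless) =
  Swr , λ c Swrc → childless c (subst S (++-assoc w r [ c ]) Swrc)

subtree-leaf⁻ : ∀ S w {r} → IsLeafOf S (w ++ r) → IsLeafOf (subtree S w) r
subtree-leaf⁻ S w {r} (Swr , childless) =
  Swr , λ c Swrc → childless c (subst S (sym (++-assoc w r [ c ])) Swrc)

leftmost-leaf : ∀ h {S} → IsTreeOfHeight S h → ¬ ¬ ∃ (IsLeftmostLeaf S)
leftmost-leaf zero {S} (S[] , _ , depth-≤ , _) = pure ([] , (S[] , childless) , λ r' _ → []-≤L r')
  where
  childless : ∀ c → ¬ S ([] ∷ʳ c)
  childless c Sc with depth-≤ [ c ] Sc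
  ... | ()
leftmost-leaf (suc h) {S} tS@(S[] , prefix-closed , _ , has-child) = do
  let c₀ , Sc₀ = has-child [] S[] (s≤s z≤n)
  c , Sc , c-least ← ¬¬-least (λ c → S [ c ]) Sc₀
  r , r-leaf , r-least ← leftmost-leaf h (subtree-isTree tS Sc refl)
  pure (c ∷ r , subtree-leaf⁺ S [ c ] r-leaf , leftmost c₀ Sc₀ c c-least r r-least)
  where
  leftmost : ∀ c₀ → S [ c₀ ] → ∀ c → (∀ c' → c' < c → ¬ S [ c' ]) →
             ∀ r → (∀ r' → IsLeafOf (subtree S [ c ]) r' → r ≤L r') →
             ∀ r' → IsLeafOf S r' → (c ∷ r) ≤L r'
  leftmost c₀ Sc₀ c c-least r r-least []         (_ , childless) = ⊥-elim (childless c₀ Sc₀)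
  leftmost c₀ Sc₀ c c-least r r-least (c' ∷ r'') r'-leaf with <-cmp c c'
  ... | tri< c<c' _ _ = inj₂ (head< c<c')
  ... | tri> _ _ c'<c = ⊥-elim (c-least c' c'<c (prefix-closed [ c' ] r'' (proj₁ r'-leaf)))
  ... | tri≈ _ refl _ with r-least r'' (subtree-leaf⁻ S [ c ] r'-leaf)
  ...   | inj₁ refl = inj₁ refl
  ...   | inj₂ r<r'' = inj₂ (tail< r<r'')

⊑-refl : ∀ {S} → S ⊑ S
⊑-refl = (λ u → u) , (λ _ Su → Su) , (λ _ _ _ _ e → e) , (λ _ c _ _ → c , refl) ,
         (λ _ _ _ _ p → p) , (λ _ l → l)

⊑-trans : ∀ {S S' S''} → S ⊑ S' → S' ⊑ S'' → S ⊑ S''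
⊑-trans {S} {S'} {S''} (f , f-node , f-inj , f-edge , f-< , f-leaf)
                       (g , g-node , g-inj , g-edge , g-< , g-leaf) =
    (λ u → g (f u))
  , (λ u Su → g-node _ (f-node u Su))
  , (λ u u' Su Su' e → f-inj u u' Su Su' (g-inj _ _ (f-node u Su) (f-node u' Su') e))
  , edge
  , (λ u u' Su Su' u<u' → g-< _ _ (f-node u Su) (f-node u' Su') (f-< u u' Su Su' u<u'))
  , (λ u l → g-leaf _ (f-leaf u l))
  where
  edge : ∀ u c → S u → S (u ∷ʳ c) → ∃ λ c'' → g (f (u ∷ʳ c)) ≡ g (f u) ∷ʳ c''
  edge u c Su Suc with f-edge u c Su Suc
  ... | c' , e with g-edge (f u) c' (f-node u Su) (subst S' e (f-node _ Suc))
  ...   | c'' , e' = c'' , trans (cong g e) e'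

module _ {S S' : OTree} {j : ℕ} (tS : IsTreeOfHeight S j) (tS' : IsTreeOfHeight S' j)
         (S⊑S' : S ⊑ S') where
  private
    f : List ℕ → List ℕ
    f = proj₁ S⊑S'

    f-edge : ∀ u c → S u → S (u ∷ʳ c) → ∃ λ c' → f (u ∷ʳ c) ≡ f u ∷ʳ c'
    f-edge = proj₁ (proj₂ (proj₂ (proj₂ S⊑S')))

    f-< : ∀ u u' → S u → S u' → u <L u' → f u <L f u'
    f-< = proj₁ (proj₂ (proj₂ (proj₂ (proj₂ S⊑S'))))

    f-leaf : ∀ u → IsLeafOf S u → IsLeafOf S' (f u)
    f-leaf = proj₂ (proj₂ (proj₂ (proj₂ (proj₂ S⊑S'))))

    prefix-closed : ∀ u s → S (u ++ s) → S u
    prefix-closed = proj₁ (proj₂ tS)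

  ⊑-extends : ∀ u w → S (w ++ u) → ∃ λ u' → f (w ++ u) ≡ f w ++ u' × length u' ≡ length u
  ⊑-extends []      w _    = [] , trans (cong f (++-identityʳ w)) (sym (++-identityʳ (f w))) , refl
  ⊑-extends (c ∷ u) w Swcu with ⊑-extends u (w ∷ʳ c) Swcu'
                            | f-edge w c (prefix-closed w (c ∷ u) Swcu) (prefix-closed (w ∷ʳ c) u Swcu')
    where Swcu' = subst S (sym (++-assoc w [ c ] u)) Swcu
  ... | u' , e , l | c' , e' = c' ∷ u' , f-wcu , cong suc l
    where
    open ≡-Reasoning
    f-wcu : f (w ++ c ∷ u) ≡ f w ++ c' ∷ u'
    f-wcu = begin
      f (w ++ c ∷ u)        ≡⟨ cong f (sym (++-assoc w [ c ] u)) ⟩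
      f ((w ∷ʳ c) ++ u)     ≡⟨ e ⟩
      f (w ∷ʳ c) ++ u'      ≡⟨ cong (_++ u') e' ⟩
      (f w ∷ʳ c') ++ u'     ≡⟨ ++-assoc (f w) [ c' ] u' ⟩
      f w ++ c' ∷ u'        ∎

  -- Both trees have all leaves at depth j, so the image of the root is the root.
  ⊑-root : ∀ {a} → IsLeafOf S a → f [] ≡ []
  ⊑-root {a} a-leaf with f [] | ⊑-extends a [] (proj₁ a-leaf)
  ... | []    | _ = refl
  ... | x ∷ r | u' , e , l = ⊥-elim (ℕ.<-irrefl refl (begin-strict
      j                        ≡⟨ sym (leaf-depth tS a-leaf) ⟩
      length a                 ≡⟨ sym l ⟩
      length u'                ≤⟨ ℕ.m≤n+m (length u') (length r) ⟩
      length r + length u'     ≡⟨ sym (length-++ r) ⟩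
      length (r ++ u')         <⟨ ℕ.n<1+n _ ⟩
      length (x ∷ r ++ u')     ≡⟨ cong length (sym e) ⟩
      length (f a)             ≡⟨ leaf-depth tS' (f-leaf a a-leaf) ⟩
      j                        ∎))
    where open ℕ.≤-Reasoning

  module _ (root : f [] ≡ []) where
    private
      as-extension : ∀ {u} → S u → ∃ λ u' → f u ≡ u' × length u' ≡ length u
      as-extension {u} Su with ⊑-extends u [] Su
      ... | u' , e , l = u' , trans e (cong (_++ u') root) , l

    ⊑-take : ∀ k {u} → S u → take k (f u) ≡ f (take k u)
    ⊑-take k {u} Su with k ℕ.≤? length u | as-extension Su | ⊑-extends (drop k u) (take k u) S[tk++dk]
      where S[tk++dk] = subst S (sym (take++drop≡id k u)) Su
    ... | yes k≤u | _ | u' , e , _ = begin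
      take k (f u)                       ≡⟨ cong (take k ∘ f) (sym (take++drop≡id k u)) ⟩
      take k (f (take k u ++ drop k u))  ≡⟨ cong (take k) e ⟩
      take k (f (take k u) ++ u')        ≡⟨ cong (λ n → take n (f (take k u) ++ u')) (sym f-tk-length) ⟩
      take (length (f (take k u))) (f (take k u) ++ u')
                                         ≡⟨ take-length-++ (f (take k u)) u' ⟩
      f (take k u)                       ∎
      where
      open ≡-Reasoning
      f-tk-length : length (f (take k u)) ≡ k
      f-tk-length with as-extension (take-node tS k Su)
      ... | _ , refl , l = trans l (trans (length-take k u) (ℕ.m≤n⇒m⊓n≡m k≤u))
    ... | no k≰u | u' , refl , l | _ = trans (take-all k (f u) (subst (_≤ k) (sym l) u≤k))
                                             (cong f (sym (take-all k u u≤k)))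
      where u≤k = ℕ.<⇒≤ (ℕ.≰⇒> k≰u)

    ⊑-take-mono-<L : ∀ k {a b} → S a → S b → take k a <L take k b → take k (f a) <L take k (f b)
    ⊑-take-mono-<L k {a} {b} Sa Sb p rewrite ⊑-take k Sa | ⊑-take k Sb =
      f-< _ _ (take-node tS k Sa) (take-node tS k Sb) p

    ⊑-take-mono-≤L : ∀ k {a b} → S a → S b → take k a ≤L take k b → take k (f a) ≤L take k (f b)
    ⊑-take-mono-≤L k {a} {b} Sa Sb (inj₁ e) rewrite ⊑-take k Sa | ⊑-take k Sb = inj₁ (cong f e)
    ⊑-take-mono-≤L k Sa Sb (inj₂ p) = inj₂ (⊑-take-mono-<L k Sa Sb p)

  ⊑-preserves-NonViolated : ∀ p {a b} → IsLeafOf S a → IsLeafOf S b →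
    NonViolated j p (leaf a) (leaf b) → NonViolated j p (leaf (f a)) (leaf (f b))
  ⊑-preserves-NonViolated p a-leaf b-leaf = NonViolated-leaf-transfer
    (⊑-take-mono-≤L (⊑-root a-leaf) _ (proj₁ b-leaf) (proj₁ a-leaf))
    (⊑-take-mono-<L (⊑-root a-leaf) _ (proj₁ b-leaf) (proj₁ a-leaf))

module _ {h j : ℕ} {pre : List ℕ} (pre-depth : length pre ≡ h ∸ j) (j≤h : j ≤ h) where

  truncL-prefix : ∀ p a → p / 2 ≤ j → truncL h p (pre ++ a) ≡ pre ++ truncL j p a
  truncL-prefix p a p≤j = trans (cong (λ k → take k (pre ++ a)) depth-split) (take-++ pre (j ∸ p / 2) a)
    where
    open ≡-Reasoning
    depth-split : h ∸ p / 2 ≡ length pre + (j ∸ p / 2)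
    depth-split = begin
      h ∸ p / 2               ≡⟨ cong (_∸ p / 2) (sym (ℕ.m∸n+n≡m j≤h)) ⟩
      (h ∸ j + j) ∸ p / 2     ≡⟨ ℕ.+-∸-assoc (h ∸ j) p≤j ⟩
      h ∸ j + (j ∸ p / 2)     ≡⟨ cong (_+ (j ∸ p / 2)) (sym pre-depth) ⟩
      length pre + (j ∸ p / 2) ∎

  NonViolated-prefix⁺ : ∀ p {a b} → p / 2 ≤ j →
    NonViolated j p (leaf a) (leaf b) → NonViolated h p (leaf (pre ++ a)) (leaf (pre ++ b))
  NonViolated-prefix⁺ p {a} {b} p≤j = NonViolated-leaf-transfer
    (subst₂ _≤L_ (sym (truncL-prefix p b p≤j)) (sym (truncL-prefix p a p≤j)) ∘ ++-monoʳ-≤L pre)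
    (subst₂ _<L_ (sym (truncL-prefix p b p≤j)) (sym (truncL-prefix p a p≤j)) ∘ ++-monoʳ-<L pre)

  NonViolated-prefix⁻ : ∀ p {a b} → p / 2 ≤ j →
    NonViolated h p (leaf (pre ++ a)) (leaf (pre ++ b)) → NonViolated j p (leaf a) (leaf b)
  NonViolated-prefix⁻ p {a} {b} p≤j = NonViolated-leaf-transfer
    (++-cancelˡ-≤L pre ∘ subst₂ _≤L_ (truncL-prefix p b p≤j) (truncL-prefix p a p≤j))
    (++-cancelˡ-<L pre ∘ subst₂ _<L_ (truncL-prefix p b p≤j) (truncL-prefix p a p≤j))

Star-transport⁻ : ∀ {A : Set} {R : A → A → Set} (P : A → Set) →
  (∀ {a b} → R a b → P b → P a) → ∀ {a b} → Star R a b → P b → P a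
Star-transport⁻ P step = fold (λ a b → P b → P a) (λ r f → step r ∘ f) (λ pb → pb)

module _ {A : Set} where

  Consec⇒related : ∀ {R : A → A → Set} {xs a b} → Linked R xs → Consec xs a b → R a b
  Consec⇒related (r ∷ _)  here      = r
  Consec⇒related (_ ∷ rs) (there c) = Consec⇒related rs c

  Consec-∷ʳ-source : ∀ xs {z a b : A} → Consec (xs ∷ʳ z) a b → a ∈ xs
  Consec-∷ʳ-source (x ∷ [])     here              = here refl
  Consec-∷ʳ-source (x ∷ y ∷ xs) here              = here refl
  Consec-∷ʳ-source (x ∷ y ∷ xs) (there c)         = there (Consec-∷ʳ-source (y ∷ xs) c)
  Consec-∷ʳ-source (x ∷ [])     (there (there ()))
  Consec-∷ʳ-source []           (there ())

  Consec-∷ʳ-target : ∀ xs {z a b : A} → Consec (xs ∷ʳ z) a b → b ∈ xs ⊎ b ≡ z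
  Consec-∷ʳ-target (x ∷ [])     here      = inj₂ refl
  Consec-∷ʳ-target (x ∷ y ∷ xs) here      = inj₁ (there (here refl))
  Consec-∷ʳ-target (x ∷ y ∷ xs) (there c) with Consec-∷ʳ-target (y ∷ xs) c
  ... | inj₁ b∈ = inj₁ (there b∈)
  ... | inj₂ e  = inj₂ e
  Consec-∷ʳ-target (x ∷ [])     (there (there ()))
  Consec-∷ʳ-target []           (there ())

  Consec-∷ʳ-successor : ∀ xs {z a : A} → a ∈ xs → ∃ (Consec (xs ∷ʳ z) a)
  Consec-∷ʳ-successor (x ∷ [])     (here refl) = _ , here
  Consec-∷ʳ-successor (x ∷ y ∷ xs) (here refl) = y , here
  Consec-∷ʳ-successor (x ∷ y ∷ xs) (there a∈) with Consec-∷ʳ-successor (y ∷ xs) a∈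
  ... | b , c = b , there c

  Consec-∷ʳ-deterministic : ∀ xs {z a b b' : A} → Unique xs →
    Consec (xs ∷ʳ z) a b → Consec (xs ∷ʳ z) a b' → b ≡ b'
  Consec-∷ʳ-deterministic (x ∷ [])     _          here       here       = refl
  Consec-∷ʳ-deterministic (x ∷ y ∷ xs) _          here       here       = refl
  Consec-∷ʳ-deterministic (x ∷ y ∷ xs) (x∉ ∷ _)   here       (there c)  =
    ⊥-elim (All¬⇒¬Any x∉ (Consec-∷ʳ-source (y ∷ xs) c))
  Consec-∷ʳ-deterministic (x ∷ y ∷ xs) (x∉ ∷ _)   (there c)  here       =
    ⊥-elim (All¬⇒¬Any x∉ (Consec-∷ʳ-source (y ∷ xs) c))
  Consec-∷ʳ-deterministic (x ∷ y ∷ xs) (_ ∷ uniq) (there c)  (there c') =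
    Consec-∷ʳ-deterministic (y ∷ xs) uniq c c'
  Consec-∷ʳ-deterministic (x ∷ [])     _          (there (there ())) _
  Consec-∷ʳ-deterministic (x ∷ [])     _          here (there (there ()))
  Consec-∷ʳ-deterministic []           _          (there ()) _

  private
    Star-there : ∀ {x : A} {xs a b} → Star (Consec xs) a b → Star (Consec (x ∷ xs)) a b
    Star-there = gmap (λ a → a) there

    path-from-head : ∀ x xs {z a : A} → a ∈ x ∷ xs → Star (Consec ((x ∷ xs) ∷ʳ z)) x a
    path-from-head x xs       (here refl) = ε
    path-from-head x (y ∷ xs) (there a∈)  = here ◅ Star-there (path-from-head y xs a∈)

    path-to-last : ∀ x xs {z a : A} → a ∈ x ∷ xs → Star (Consec ((x ∷ xs) ∷ʳ z)) a z
    path-to-last x []       (here refl) = here ◅ ε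
    path-to-last x (y ∷ xs) (here refl) = here ◅ Star-there (path-to-last y xs (here refl))
    path-to-last x (y ∷ xs) (there a∈)  = Star-there (path-to-last y xs a∈)

  Consec-cycle-path : ∀ x xs {a b : A} → a ∈ x ∷ xs → b ∈ x ∷ xs →
    Star (Consec ((x ∷ xs) ∷ʳ x)) a b
  Consec-cycle-path x xs a∈ b∈ = path-to-last x xs a∈ ◅◅ path-from-head x xs b∈

at⇒∈ : ∀ {A : Set} {x : A} xs i → at xs i ≡ just x → x ∈ xs
at⇒∈ (y ∷ xs) zero    refl = here refl
at⇒∈ (y ∷ xs) (suc i) e    = there (at⇒∈ xs i e)

∈⇒at : ∀ {A : Set} {x : A} {xs} → x ∈ xs → ∃ λ i → at xs i ≡ just x
∈⇒at (here refl) = 0 , refl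
∈⇒at (there x∈)  with ∈⇒at x∈
... | i , e = suc i , e

chain-⊑ : ∀ (T : OTree) ch → (∀ x y → Consec ch x y → subtree T x ⊏ subtree T y) →
  ∀ a b {u w} → at ch a ≡ just u → at ch b ≡ just w → a ≤ b → subtree T u ⊑ subtree T w
chain-⊑ T (x ∷ ch)     strict zero    zero    refl refl _ = ⊑-refl
chain-⊑ T (x ∷ y ∷ ch) strict zero    (suc b) {w = w} refl e _ =
  ⊑-trans {subtree T x} {subtree T y} {subtree T w} (proj₁ (strict x y here))
          (chain-⊑ T (y ∷ ch) (λ p q c → strict p q (there c)) zero b refl e z≤n)
chain-⊑ T (x ∷ ch)     strict (suc a) (suc b) ea   eb   (s≤s a≤b) =
  chain-⊑ T ch (λ p q c → strict p q (there c)) a b ea eb a≤b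

module CycleFeasibility {n d : ℕ} (G : Game n d) (τ : Fin n → Fin n) (C : Cycle (Eτ G τ)) where
  open Game G
  open GameDefs G using (Feasible)
  open import Data.List.Membership.DecPropositional (_≟_ {n}) using (_∈?_)

  nodes : List (Fin n)
  nodes = cycNodes C

  Arc : Fin n → Fin n → Set
  Arc = Sub.arcs (asSub C)

  arc-source∈ : ∀ {a b} → Arc a b → a ∈ nodes
  arc-source∈ = Consec-∷ʳ-source nodes

  arc-target∈ : ∀ {a b} → Arc a b → b ∈ nodes
  arc-target∈ c with Consec-∷ʳ-target nodes c
  ... | inj₁ b∈   = b∈
  ... | inj₂ refl = here refl

  arc⇒Eτ : ∀ {a b} → Arc a b → Eτ G τ a b
  arc⇒Eτ = Consec⇒related (Cycle.linked C)

  successor : ∀ {a} → a ∈ nodes → ∃ (Arc a)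
  successor = Consec-∷ʳ-successor nodes

  path : ∀ {a b} → a ∈ nodes → b ∈ nodes → Star Arc a b
  path = Consec-cycle-path (Cycle.hd C) (Cycle.tl C)

  feasible⇒arcs-NonViolated : ∀ {m ν} → Feasible m ν (asSub C) →
    ∀ {a b} → Arc a b → NonViolated m (prio a) (ν a) (ν b)
  feasible⇒arcs-NonViolated (σ , _ , σ-in-C , nonviolated) {a} {b} c with owner a in owner-a
  ... | Odd  = nonviolated a b c (inj₁ owner-a)
  ... | Even = nonviolated a b c
                 (inj₂ (owner-a , Consec-∷ʳ-deterministic nodes (Cycle.uniq C) c (σ-in-C a owner-a (b , c))))

  arcs-NonViolated⇒feasible : ∀ {m ν} → (∀ {a b} → Arc a b → NonViolated m (prio a) (ν a) (ν b)) →
    Feasible m ν (asSub C)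
  arcs-NonViolated⇒feasible nonviolated = σ , σ-legal , σ-in-C , λ a b c _ → nonviolated c
    where
    σ : Fin n → Fin n
    σ u with u ∈? nodes
    ... | yes u∈ = proj₁ (successor u∈)
    ... | no  _  = proj₁ (total u)

    σ-legal : ∀ u → owner u ≡ Even → E u (σ u)
    σ-legal u even with u ∈? nodes
    ... | no  _  = proj₂ (total u)
    ... | yes u∈ with arc⇒Eτ (proj₂ (successor u∈))
    ...   | inj₁ (_ , e)   = e
    ...   | inj₂ (odd , _) with trans (sym even) odd
    ...     | ()

    σ-in-C : ∀ u → owner u ≡ Even → ∃ (Arc u) → Arc u (σ u)
    σ-in-C u _ (_ , c) with u ∈? nodes
    ... | yes u∈ = proj₂ (successor u∈)
    ... | no  u∉ = ⊥-elim (u∉ (arc-source∈ c))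

module Threshold {n d : ℕ} (G : Game n d) (τ : Fin n → Fin n)
                 (T : OTree) (T-tree : IsTreeOfHeight T (d / 2)) (𝒞 : Cover T (d / 2))
                 (μ : Fin n → Lab) (v : Fin n) (v-even : 2 ∣ Game.prio G v) where
  open Game G
  open GameDefs G
  open WithTau τ
  open Cover 𝒞
  open Alpha G τ T (d / 2) 𝒞
  open import Data.List.Membership.DecPropositional (_≟_ {n}) using (_∈?_)

  h : ℕ
  h = d / 2

  j : ℕ
  j = prio v / 2

  j≤h : j ≤ h
  j≤h = /-monoˡ-≤ 2 (proj₂ (prio-range v))

  ancestor : List ℕ → List ℕ
  ancestor = take (h ∸ j)

  ancestor-node : ∀ {s} → IsLeafOf T s → T (ancestor s) × length (ancestor s) ≡ h ∸ j
  ancestor-node {s} s-leaf = take-node T-tree (h ∸ j) (proj₁ s-leaf) , (begin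
    length (take (h ∸ j) s)   ≡⟨ length-take (h ∸ j) s ⟩
    (h ∸ j) ⊓ length s        ≡⟨ cong ((h ∸ j) ⊓_) (leaf-depth T-tree s-leaf) ⟩
    (h ∸ j) ⊓ h               ≡⟨ ℕ.m≤n⇒m⊓n≡m (ℕ.m∸n≤m h j) ⟩
    h ∸ j                     ∎)
    where open ≡-Reasoning

  ancestor-++ : ∀ {pre} → length pre ≡ h ∸ j → ∀ r → ancestor (pre ++ r) ≡ pre
  ancestor-++ {pre} pre-depth r = trans (cong (λ k → take k (pre ++ r)) (sym pre-depth)) (take-length-++ pre r)

  ancestor-split : ∀ {pre} s → ancestor s ≡ pre → s ≡ pre ++ drop (h ∸ j) s
  ancestor-split s e = trans (sym (take++drop≡id (h ∸ j) s)) (cong (_++ drop (h ∸ j) s) e)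

  truncL-2j : ∀ xs → truncL h (2 * j) xs ≡ ancestor xs
  truncL-2j xs = cong (λ k → take (h ∸ k) xs) (trans (cong (_/ 2) (ℕ.*-comm 2 j)) (m*n/n≡m j 2))

  subtree-at-level : ∀ {w} → T w × length w ≡ h ∸ j → IsTreeOfHeight (subtree T w) j
  subtree-at-level (Tw , w-depth) = subtree-isTree T-tree Tw (trans (cong (_+ j) w-depth) (ℕ.m∸n+n≡m j≤h))

  chain-node : ∀ k i {u} → chainAt j k i ≡ just u → T u × length u ≡ h ∸ j
  chain-node k i e = elems j j≤h _ (∈-lookup {xs = chains j} k) _ (at⇒∈ _ i e)

  chainAt-⊑ : ∀ k {a b u w} → chainAt j k a ≡ just u → chainAt j k b ≡ just w → a ≤ b →
    subtree T u ⊑ subtree T w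
  chainAt-⊑ k = chain-⊑ T _ (strict j j≤h _ (∈-lookup {xs = chains j} k)) _ _

  covering-chain : ∀ {w} → T w × length w ≡ h ∸ j →
    ∃ λ k → ∃ λ i → ∃ λ u → chainAt j k i ≡ just u × subtree T w ≡T subtree T u
  covering-chain (Tw , w-depth) with covering j j≤h _ Tw w-depth
  ... | ch , ch∈ , u , u∈ , w≡u with ∈⇒at u∈
  ...   | i , u-at =
    Any.index ch∈ , i , u , subst (λ xs → at xs i ≡ just u) (lookup-index ch∈) u-at , w≡u

  leftmost-below : ∀ {pre r} → IsLeftmostLeaf (subtree T pre) r →
    ∀ ζ → IsLeafOf T ζ → ancestor ζ ≡ pre → (pre ++ r) ≤L ζ
  leftmost-below {pre} {r} (_ , r-least) ζ ζ-leaf ζ-below =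
    subst ((pre ++ r) ≤L_) (sym split)
      (++-monoʳ-≤L pre (r-least _ (subtree-leaf⁻ T pre (subst (IsLeafOf T) split ζ-leaf))))
    where split = ancestor-split ζ ζ-below

  module OnCycle (C : CycleGτ) (v-dom : Dominates prio v C) where
    open CycleFeasibility G τ C

    v∈ : v ∈ nodes
    v∈ = proj₁ v-dom

    prio-≤ : ∀ {a} → a ∈ nodes → prio a / 2 ≤ j
    prio-≤ a∈ = /-monoˡ-≤ 2 (proj₂ v-dom _ a∈)

    finite-feasible-⊑ : ∀ {S S'} → IsTreeOfHeight S j → IsTreeOfHeight S' j → S ⊑ S' →
      AdmitsFiniteFeasible j S (asSub C) → AdmitsFiniteFeasible j S' (asSub C)
    finite-feasible-⊑ {S} {S'} tS tS' S⊑S'@(f , _ , _ , _ , _ , f-leaf) (ν , ν-finite , ν-feasible) =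
      mapLab f ∘ ν , finite , arcs-NonViolated⇒feasible arcs
      where

      finite : ∀ u → u ∈ nodes → ∃ λ s → mapLab f (ν u) ≡ leaf s × IsLeafOf S' s
      finite u u∈ with ν-finite u u∈
      ... | r , e , r-leaf rewrite e = f r , refl , f-leaf r r-leaf

      arcs : ∀ {a b} → Arc a b → NonViolated j (prio a) (mapLab f (ν a)) (mapLab f (ν b))
      arcs {a} {b} c with ν-finite a (arc-source∈ c) | ν-finite b (arc-target∈ c)
                        | feasible⇒arcs-NonViolated ν-feasible c
      ... | _ , ea , a-leaf | _ , eb , b-leaf | nv rewrite ea | eb =
        ⊑-preserves-NonViolated tS tS' S⊑S' (prio a) a-leaf b-leaf nv

    top-candidate : ThresholdCand T h μ v top
    top-candidate = (λ _ → top) , (λ _ → tt) , refl , ≤Lab-top (μ v) , C , v-dom ,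
                    arcs-NonViolated⇒feasible {m = h} {ν = λ _ → top} (λ {a} _ → NonViolated-top h (prio a))

    extension-candidate : ∀ {ξ'} → IsLeafOf T ξ' → μ v ≤Lab leaf ξ' →
      (∀ r → IsLeafOf T (ancestor ξ' ++ r) → ξ' ≤L (ancestor ξ' ++ r)) →
      AdmitsFiniteFeasible j (subtree T (ancestor ξ')) (asSub C) →
      ThresholdCand T h μ v (leaf ξ')
    extension-candidate {ξ'} ξ'-leaf μv≤ξ' ξ'-leftmost (ν , ν-finite , ν-feasible) =
      μ~ , μ~-in-T , μ~-v , μv≤ξ' , C , v-dom , arcs-NonViolated⇒feasible arcs
      where
      pre : List ℕ
      pre = ancestor ξ'

      pre-depth : length pre ≡ h ∸ j
      pre-depth = proj₂ (ancestor-node ξ'-leaf)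

      μ~ : Fin n → Lab
      μ~ x with x ≟ v | x ∈? nodes
      ... | yes _ | _     = leaf ξ'
      ... | no _  | yes _ = mapLab (pre ++_) (ν x)
      ... | no _  | no _  = top

      μ~-v : μ~ v ≡ leaf ξ'
      μ~-v with v ≟ v
      ... | yes _ = refl
      ... | no v≢v = ⊥-elim (v≢v refl)

      μ~-in-T : ∀ u → InLbar T (μ~ u)
      μ~-in-T u with u ≟ v | u ∈? nodes
      ... | yes _ | _      = ξ'-leaf
      ... | no _  | no _   = tt
      ... | no _  | yes u∈ with ν-finite u u∈
      ...   | r , e , r-leaf rewrite e = subtree-leaf⁺ T pre r-leaf

      μ~-on-cycle : ∀ {x} → x ∈ nodes → (x ≡ v × μ~ x ≡ leaf ξ') ⊎ μ~ x ≡ mapLab (pre ++_) (ν x)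
      μ~-on-cycle {x} x∈ with x ≟ v | x ∈? nodes
      ... | yes x≡v | _     = inj₁ (x≡v , refl)
      ... | no _    | yes _ = inj₂ refl
      ... | no _    | no x∉ = ⊥-elim (x∉ x∈)

      μ~-≤ : ∀ {x r} → x ∈ nodes → ν x ≡ leaf r → IsLeafOf (subtree T pre) r →
             μ~ x ≤Lab leaf (pre ++ r)
      μ~-≤ x∈ e r-leaf with μ~-on-cycle x∈
      ... | inj₁ (_ , e~) =
        subst (_≤Lab _) (sym e~) (leaf-≤Lab (ξ'-leftmost _ (subtree-leaf⁺ T pre r-leaf)))
      ... | inj₂ e~       = inj₁ (trans e~ (cong (mapLab (pre ++_)) e))

      μ~-nonviolated : ∀ {x r b} → x ∈ nodes → ν x ≡ leaf r →
        NonViolated h (prio x) (leaf (pre ++ r)) b → NonViolated h (prio x) (μ~ x) b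
      μ~-nonviolated {r = r} x∈ e nv with μ~-on-cycle x∈
      ... | inj₁ (refl , e~) = subst (λ y → NonViolated h (prio v) y _) (sym e~)
        (NonViolated-even-respects-trunc h (prio v) v-even (cong leaf (ancestor-++ pre-depth r)) nv)
      ... | inj₂ e~ = subst (λ y → NonViolated h (prio _) y _) (sym (trans e~ (cong (mapLab (pre ++_)) e))) nv

      arcs : ∀ {a b} → Arc a b → NonViolated h (prio a) (μ~ a) (μ~ b)
      arcs {a} {b} c with ν-finite a (arc-source∈ c) | ν-finite b (arc-target∈ c)
      ... | ra , ea , _ | rb , eb , rb-leaf =
        μ~-nonviolated (arc-source∈ c) ea
          (NonViolated-antitoneʳ h (prio a)
            (NonViolated-prefix⁺ pre-depth j≤h (prio a) (prio-≤ (arc-source∈ c))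
              (subst₂ (NonViolated j (prio a)) ea eb (feasible⇒arcs-NonViolated ν-feasible c)))
            (μ~-≤ (arc-target∈ c) eb rb-leaf))

    module Candidate {μ~ : Fin n → Lab} {s : List ℕ} (μ~-in-T : ∀ u → InLbar T (μ~ u))
                     (μ~-v : μ~ v ≡ leaf s) (μ~-feasible : Feasible h μ~ (asSub C)) where
      private
        arc-nonviolated : ∀ {a b} → Arc a b → NonViolated h (prio a) (μ~ a) (μ~ b)
        arc-nonviolated = feasible⇒arcs-NonViolated μ~-feasible

        cut : Lab → Lab
        cut = trunc h (prio v)

      s-leaf : IsLeafOf T s
      s-leaf = subst (InLbar T) μ~-v (μ~-in-T v)

      pre : List ℕ
      pre = ancestor s

      pre-node : T pre × length pre ≡ h ∸ j
      pre-node = ancestor-node s-leaf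

      cut-antitone : ∀ {a b} → Arc a b → cut (μ~ b) ≤Lab cut (μ~ a)
      cut-antitone {a} c =
        subst₂ _≤Lab_ (trunc-trunc h (prio a) (prio v) (prio-≤ (arc-source∈ c)))
                      (trunc-trunc h (prio a) (prio v) (prio-≤ (arc-source∈ c)))
               (trunc-mono-≤Lab h (prio v) (NonViolated⇒trunc-≤ h (prio a) (arc-nonviolated c)))

      cut-antitone⋆ : ∀ {a b} → Star Arc a b → cut (μ~ b) ≤Lab cut (μ~ a)
      cut-antitone⋆ =
        fold (λ a b → cut (μ~ b) ≤Lab cut (μ~ a)) (λ c rest → ≤Lab-trans rest (cut-antitone c)) (inj₁ refl)

      cut-constant : ∀ {x} → x ∈ nodes → cut (μ~ x) ≡ leaf pre
      cut-constant {x} x∈ = subst (λ y → cut (μ~ x) ≡ cut y) μ~-v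
        (≤Lab-antisym (cut-antitone⋆ (path v∈ x∈)) (cut-antitone⋆ (path x∈ v∈)))

      below-pre : ∀ {x} → x ∈ nodes → ∃ λ l → μ~ x ≡ leaf l × l ≡ pre ++ drop (h ∸ j) l
      below-pre x∈ with trunc≡leaf⁻ h (prio v) (cut-constant x∈)
      ... | l , e , anc = l , e , ancestor-split l anc

      restriction : AdmitsFiniteFeasible j (subtree T pre) (asSub C)
      restriction = ν , finite , arcs-NonViolated⇒feasible arcs
        where
        ν : Fin n → Lab
        ν = mapLab (drop (h ∸ j)) ∘ μ~

        finite : ∀ u → u ∈ nodes → ∃ λ r → ν u ≡ leaf r × IsLeafOf (subtree T pre) r
        finite u u∈ with below-pre u∈
        ... | l , e , split = drop (h ∸ j) l , cong (mapLab (drop (h ∸ j))) e ,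
                              subtree-leaf⁻ T pre (subst (IsLeafOf T) split (subst (InLbar T) e (μ~-in-T u)))

        arcs : ∀ {a b} → Arc a b → NonViolated j (prio a) (ν a) (ν b)
        arcs {a} c with below-pre (arc-source∈ c) | below-pre (arc-target∈ c) | arc-nonviolated c
        ... | la , ea , split-a | lb , eb , split-b | nv rewrite ea | eb =
          NonViolated-prefix⁻ (proj₂ pre-node) j≤h (prio a) (prio-≤ (arc-source∈ c))
            (subst₂ (λ x y → NonViolated h (prio a) (leaf x) (leaf y)) split-a split-b nv)

      module _ (no-loose : NoLooseArcs T h μ) (μv≤s : μ v ≤Lab leaf s) where

        μ≤μ~ : ∀ {x} → x ∈ nodes → μ x ≤Lab μ~ x
        μ≤μ~ x∈ = Star-transport⁻ (λ x → μ x ≤Lab μ~ x) step (path x∈ v∈)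
                                  (subst (μ v ≤Lab_) (sym μ~-v) μv≤s)
          where
          -- If μ~(a) < μ(a), then μ~(a) witnesses that the non-violated arc ab is not tight for μ.
          step : ∀ {a b} → Arc a b → μ b ≤Lab μ~ b → μ a ≤Lab μ~ a
          step {a} {b} c μb≤ = decidable-stable (μ a ≤Lab? μ~ a) λ μa≰μ~a →
            no-loose a b (arc⇒Eτ c) (NonViolated-monoˡ h (prio a) nv (≰Lab⇒≥Lab μa≰μ~a) ,
                                     λ tight → μa≰μ~a (proj₂ tight (μ~ a) (μ~-in-T a) nv))
            where
            nv : NonViolated h (prio a) (μ~ a) (μ b)
            nv = NonViolated-antitoneʳ h (prio a) (arc-nonviolated c) μb≤

        cut-successor≤ : ∀ {c₁ ℓ} → Arc v c₁ → ancestor ℓ ≡ pre → cut (μ c₁) ≤Lab cut (leaf ℓ)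
        cut-successor≤ arc ℓ-below = subst (λ y → cut (μ _) ≤Lab leaf y) (sym ℓ-below) (
          ≤Lab-trans (trunc-mono-≤Lab h (prio v) (μ≤μ~ (arc-target∈ arc)))
                     (subst (λ y → cut (μ~ _) ≤Lab y) (cut-constant v∈) (cut-antitone arc)))

        μv≤leaf-below-pre : ∀ {ℓ} → IsLeafOf T ℓ → ancestor ℓ ≡ pre → μ v ≤Lab leaf ℓ
        μv≤leaf-below-pre {ℓ} ℓ-leaf ℓ-below with successor v∈
        ... | c₁ , arc with <Lab-≤Lab-total (cut (μ v)) (cut (μ c₁))
        ...   | inj₁ μv<μc₁ =
          inj₂ (trunc-reflects-<Lab h (prio v) (<Lab-≤Lab-trans μv<μc₁ (cut-successor≤ arc ℓ-below)))
        ...   | inj₂ μc₁≤μv = decidable-stable (μ v ≤Lab? leaf ℓ) λ μv≰ℓ →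
                  no-loose v c₁ (arc⇒Eτ arc) (inj₁ (v-even , μc₁≤μv) , λ tight →
                    μv≰ℓ (proj₂ tight (leaf ℓ) ℓ-leaf (inj₁ (v-even , cut-successor≤ arc ℓ-below))))

  module Characterisation
    (no-loose : NoLooseArcs T h μ) (C₀ : CycleGτ) (C₀-dom : Dominates prio v C₀)
    (α : Fin (length (chains j)) → ℕ∞) (α-spec : ∀ k → IsAlphaNode j k v (α k))
    (ξ : Fin (length (chains j)) → Lab) (ξ-spec : ∀ k → IsXi (μ v) j k (α k) (ξ k)) where

    some-chain : Fin (length (chains j))
    some-chain = proj₁ (covering-chain (proj₂ (node-at-depth T-tree (h ∸ j) (ℕ.m∸n≤m h j))))

    raise-candidate : ∀ {k a ua ξ'} (C : CycleGτ) → Dominates prio v C →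
      chainAt j k a ≡ just ua → AdmitsFiniteFeasible j (subtree T ua) (asSub C) →
      RaiseCand (μ v) a j k (leaf ξ') → ThresholdCand T h μ v (leaf ξ')
    raise-candidate {k} {a} {ua} {ξ'} C v-dom ua-at ua-feasible
                    (ξ'-leaf , μv≤ξ' , ξ'-leftmost , i , a≤i , u , u-at , ξ'≡u) =
      extension-candidate ξ'-leaf μv≤ξ' leftmost
        (finite-feasible-⊑ (subtree-at-level (chain-node k a ua-at)) (subtree-at-level pre-node)
                           ua⊑pre ua-feasible)
      where
      open OnCycle C v-dom

      pre-node : T (ancestor ξ') × length (ancestor ξ') ≡ h ∸ j
      pre-node = ancestor-node ξ'-leaf

      ua⊑pre : subtree T ua ⊑ subtree T (ancestor ξ')
      ua⊑pre = ⊑-trans {subtree T ua} {subtree T u} {subtree T (ancestor ξ')}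
                 (chainAt-⊑ k ua-at u-at a≤i)
                 (subst (λ w → subtree T u ⊑ subtree T w) (truncL-2j ξ') (proj₂ ξ'≡u))

      leftmost : ∀ r → IsLeafOf T (ancestor ξ' ++ r) → ξ' ≤L (ancestor ξ' ++ r)
      leftmost r r-leaf = ξ'-leftmost _ r-leaf
        (trans (truncL-2j _) (trans (ancestor-++ (proj₂ pre-node) r) (sym (truncL-2j ξ'))))

    ξ-candidate : ∀ k → ThresholdCand T h μ v (ξ k)
    ξ-candidate k with ξ k | α k | ξ-spec k | α-spec k
    ... | top    | _       | _           | _ = OnCycle.top-candidate C₀ C₀-dom
    ... | leaf _ | nothing | ()          | _
    ... | leaf _ | just a  | (raise , _) | (C , v-dom , (ua , ua-at , ua-feasible) , _) , _ =
      raise-candidate C v-dom ua-at ua-feasible raise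

    raise-lower-bound : ∀ k {m i u ℓ} → α k ≤∞ just m → m ≤ i → chainAt j k i ≡ just u →
      subtree T (ancestor ℓ) ≡T subtree T u → IsLeafOf T ℓ → μ v ≤Lab leaf ℓ →
      (∀ ζ → IsLeafOf T ζ → ancestor ζ ≡ ancestor ℓ → ℓ ≤L ζ) → ξ k ≤Lab leaf ℓ
    raise-lower-bound k {i = i} {u} {ℓ} α≤m m≤i u-at ℓ≡u ℓ-leaf μv≤ℓ ℓ-leftmost
      with α k | ξ-spec k | α≤m
    ... | just a | (_ , ξ-least) | fin≤fin a≤m =
      ξ-least (leaf ℓ) (ℓ-leaf , μv≤ℓ , leftmost , i , ℕ.≤-trans a≤m m≤i , u , u-at ,
                        subst (λ w → subtree T w ≡T subtree T u) (sym (truncL-2j ℓ)) ℓ≡u)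
      where
      leftmost : ∀ ζ → IsLeafOf T ζ → truncL h (2 * j) ζ ≡ truncL h (2 * j) ℓ → ℓ ≤L ζ
      leftmost ζ ζ-leaf e = ℓ-leftmost ζ ζ-leaf (trans (sym (truncL-2j ζ)) (trans e (truncL-2j ℓ)))

    candidate-above-some-ξ : ∀ {s} → ThresholdCand T h μ v (leaf s) → ¬ ¬ ∃ λ k → ξ k ≤Lab leaf s
    candidate-above-some-ξ {s} (μ~ , μ~-in-T , μ~-v , μv≤s , C , v-dom , μ~-feasible) = do
      let k , i , u , u-at , pre≡u = covering-chain pre-node
          u-feasible = finite-feasible-⊑ (subtree-at-level pre-node) (subtree-at-level (chain-node k i u-at))
                                          (proj₁ pre≡u) restriction
      m , m-feasible , m-least ← ¬¬-least (λ i → ∃ λ u → chainAt j k i ≡ just u ×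
                                                        AdmitsFiniteFeasible j (subtree T u) (asSub C))
                                          (u , u-at , u-feasible)
      r , r-leftmost ← leftmost-leaf j (subtree-at-level pre-node)
      let ℓ-leaf = subtree-leaf⁺ T pre (proj₁ r-leftmost)
          ℓ-below = ancestor-++ (proj₂ pre-node) r
          m≤i = ℕ.≮⇒≥ (λ i<m → m-least i i<m (u , u-at , u-feasible))
          α≤m = proj₂ (α-spec k) (just m) (C , v-dom , m-feasible , m-least)
      pure (k , ≤Lab-trans
        (raise-lower-bound k α≤m m≤i u-at (subst (λ w → subtree T w ≡T subtree T u) (sym ℓ-below) pre≡u)
           ℓ-leaf
           (μv≤leaf-below-pre no-loose μv≤s ℓ-leaf ℓ-below)
           (λ ζ ζ-leaf ζ-below → leftmost-below r-leftmost ζ ζ-leaf (trans ζ-below ℓ-below)))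
        (leaf-≤Lab (leftmost-below r-leftmost s s-leaf refl)))
      where
      open OnCycle C v-dom
      open Candidate μ~-in-T μ~-v μ~-feasible

lemma4p8 : ∀ {n d} (G : Game n d) (τ : Fin n → Fin n) → OddStrategy G τ →
    (T : OTree) → IsUniversal n (d / 2) T → (𝒞 : Cover T (d / 2)) →
    (μ : Fin n → Lab) → (∀ u → InLbar T (μ u)) →
    GameDefs.WithTau.NoLooseArcs G τ T (d / 2) μ →
    (v : Fin n) → GameDefs.WithTau.BaseNode G τ v →
    (α : Fin (length (Cover.chains 𝒞 (Game.prio G v / 2))) → ℕ∞) →
    (∀ k → Alpha.IsAlphaNode G τ T (d / 2) 𝒞 (Game.prio G v / 2) k v (α k)) →
    (ξ : Fin (length (Cover.chains 𝒞 (Game.prio G v / 2))) → Lab) →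
    (∀ k → Alpha.IsXi G τ T (d / 2) 𝒞 (μ v) (Game.prio G v / 2) k (α k) (ξ k)) →
    ∃ λ y → IsLeast _≤Lab_ (GameDefs.WithTau.ThresholdCand G τ T (d / 2) μ v) y
          × IsLeast _≤Lab_ (λ x → ∃ λ k → ξ k ≡ x) y
-- Universality of T is used only through its tree structure.
lemma4p8 {d = d} G τ _ T (T-tree , _) 𝒞 μ _ no-loose v (C₀ , C₀-dom , v-even) α α-spec ξ ξ-spec =
  ξ k-min , (ξ-candidate k-min , lower-bound) , (k-min , refl) , λ { _ (k , refl) → k-min-least k }
  where
  open Threshold G τ T T-tree 𝒞 μ v v-even
  open Characterisation no-loose C₀ C₀-dom α α-spec ξ ξ-spec

  minimum : ∃ λ k → ∀ k' → ξ k ≤Lab ξ k'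
  minimum = argmin some-chain ξ

  k-min : Fin (length (Cover.chains 𝒞 j))
  k-min = proj₁ minimum

  k-min-least : ∀ k → ξ k-min ≤Lab ξ k
  k-min-least = proj₂ minimum

  lower-bound : ∀ y → GameDefs.WithTau.ThresholdCand G τ T (d / 2) μ v y → ξ k-min ≤Lab y
  lower-bound top      _    = ≤Lab-top _
  lower-bound (leaf s) cand = decidable-stable (ξ k-min ≤Lab? leaf s)
    (¬¬-map (λ (k , ξk≤s) → ≤Lab-trans (k-min-least k) ξk≤s) (candidate-above-some-ξ cand))
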